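{- For the complete bipartite graph $K_{m,n}$ with $m\ge n\ge 1$, $\bar{\gamma}_p(K_{m,n})=m-2$ if $m\ge 2$, and $\bar{\gamma}_p(K_{m,n})=0$ otherwise.
   Context: For $v\in V$, $N[v]$ is the closed neighborhood; for $S\subseteq V$, $N[S]=\bigcup_{v\in S}N[v]$. Define $\mathcal{P}^0(S)=N[S]$, $\mathcal{P}^{i+1}(S)=\mathcal{P}^i(S)\cup\{w : \{w\}=N[v]\setminus\mathcal{P}^i(S)\text{ for some } v\in\mathcal{P}^i(S)\}$, with eventual value $\mathcal{P}^\infty(S)$. $S$ is a power dominating set (PDS) if $\mathcal{P}^\infty(S)=V$, and a failed power dominating set (FPDS) otherwise. $\bar{\gamma}_p(G)$ is the maximum cardinality of an FPDS of $G$. -}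

module Defs where

open import Data.Nat using (ℕ; zero; suc; _≤_; _<_; _+_)
open import Data.Nat.Properties using (<-irrefl; <⇒≱; ≤-refl)
open import Data.Fin using (Fin; toℕ)
open import Data.Fin.Subset using (Subset; _∈_; ∣_∣)
open import Data.Product using (Σ; ∃; _×_; _,_)
open import Data.Sum using (_⊎_; inj₁; inj₂)
open import Data.Empty using (⊥)
open import Relation.Nullary using (¬_)
open import Relation.Binary.PropositionalEquality using (_≡_; refl)

record Graph (V : ℕ) : Set₁ where
  field
    Adj     : Fin V → Fin V → Set
    sym     : ∀ {u v} → Adj u v → Adj v u
    irrefl  : ∀ {v} → ¬ Adj v v

open Graph public

InN : ∀ {V} → Graph V → Fin V → Fin V → Set
InN G v w = (w ≡ v) ⊎ Adj G v w

P : ∀ {V} → Graph V → Subset V → ℕ → Fin V → Set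
P G S zero    w = ∃ λ v → (v ∈ S) × InN G v w
P G S (suc i) w =
  P G S i w ⊎
  (∃ λ v → P G S i v × InN G v w × ¬ P G S i w ×
     (∀ u → InN G v u → ¬ P G S i u → u ≡ w))

P∞ : ∀ {V} → Graph V → Subset V → Fin V → Set
P∞ G S w = ∃ λ i → P G S i w

IsPDS : ∀ {V} → Graph V → Subset V → Set
IsPDS G S = ∀ w → P∞ G S w

IsFPDS : ∀ {V} → Graph V → Subset V → Set
IsFPDS G S = ¬ IsPDS G S

FPDSNumber : ∀ {V} → Graph V → ℕ → Set
FPDSNumber {V} G k =
  (Σ (Subset V) λ S → IsFPDS G S × ∣ S ∣ ≡ k) ×
  (∀ (S : Subset V) → IsFPDS G S → ∣ S ∣ ≤ k)

-- complete bipartite graph K_{m,n} on Fin (m + n):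
-- vertices with toℕ < m form one part, the rest the other part.
KAdj : (m n : ℕ) → Fin (m + n) → Fin (m + n) → Set
KAdj m n u v = (toℕ u < m × m ≤ toℕ v) ⊎ (m ≤ toℕ u × toℕ v < m)

K : (m n : ℕ) → Graph (m + n)
K m n = record
  { Adj = KAdj m n
  ; sym = λ { (inj₁ (a , b)) → inj₂ (b , a) ; (inj₂ (a , b)) → inj₁ (b , a) }
  ; irrefl = λ { (inj₁ (a , b)) → <⇒≱ a b ; (inj₂ (a , b)) → <⇒≱ b a }
  }

-- Write A for the part {w | toℕ w < m} (m vertices) and B for the rest
-- (n vertices).  Two general facts about power domination drive the proof.
--   * Lower bound: if a vertex set I contains N[S] and is closed under
--     forcing, then P∞(S) ⊆ I; so S fails as soon as some vertex lies
--     outside I.  For m = k + 2 the set S of the first k vertices of A fails,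
--     with I = S ∪ B: every vertex of B sees the two unobserved vertices
--     k, k + 1 of A and can never force.  For m = 1 the empty set fails.
--   * Upper bound: if an observed vertex c is adjacent to every unobserved
--     vertex and at most one vertex is unobserved, S is power dominating.
--     If S meets both parts, N[S] = V.  If S lies in one part and meets it,
--     N[S] contains the other part, any vertex c of that other part sees
--     all of S's part, and |S| > m - 2 leaves at most one vertex of S's
--     part (of size ≤ m) unobserved, by counting.  Hence every failed
--     power dominating set has at most m - 2 vertices.
module Submission where

open import Defs
open import Data.Nat using (ℕ; _≤_; _<_; _∸_)
open import Data.Product using (_×_; Σ; ∃; _,_; proj₁; proj₂)

open import Data.Nat using (zero; suc; _+_; z≤n; s≤s; _≤?_; _<?_)
open import Data.Nat.Properties
  using (≤-trans; ≤-reflexive; <-trans; <⇒≱; ≮⇒≥; ≰⇒>; n<1+n; n≤1+n; 1+n≢n; m≤m+n; m≤n+m;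
         m<m+n; +-monoʳ-≤; ∸-monoˡ-≤; m+n∸m≡n; module ≤-Reasoning)
open import Data.Fin using (Fin; toℕ; fromℕ<; _≟_)
open import Data.Fin.Properties using (toℕ-fromℕ<; any?)
open import Data.Fin.Subset
  using (Subset; _∈_; _∉_; _⊆_; ∣_∣; ∁; _-_; inside)
  renaming (⊥ to ∅)
open import Data.Fin.Subset.Properties
  using (_∈?_; ∉⊥; ∣⊥∣≡0; ∣∁p∣≡n∸∣p∣; x∉p⇒x∈∁p; p⊆q⇒∣p∣≤∣q∣;
         x∈p∧x≢y⇒x∈p-y; x∈p⇒∣p-x∣<∣p∣)
open import Data.Vec using ([]; _∷_; here; there)
open import Data.Sum using (_⊎_; inj₁; inj₂)
open import Data.Empty using (⊥-elim) renaming (⊥ to False)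
open import Relation.Nullary using (¬_; Dec; yes; no; _×-dec_; _⊎-dec_)
open import Relation.Binary.PropositionalEquality
  using (_≡_; _≢_; refl; trans; cong; subst)
  renaming (sym to ≡-sym)

two-missing : ∀ {N} {S T : Subset N} {x y : Fin N} → S ⊆ T →
  x ∈ T → y ∈ T → x ≢ y → x ∉ S → y ∉ S → 2 + ∣ S ∣ ≤ ∣ T ∣
two-missing {S = S} {T} {x} {y} S⊆T x∈T y∈T x≢y x∉S y∉S = begin
  2 + ∣ S ∣         ≤⟨ +-monoʳ-≤ 2 (p⊆q⇒∣p∣≤∣q∣ S⊆T-x-y) ⟩
  2 + ∣ T - x - y ∣ ≤⟨ s≤s (x∈p⇒∣p-x∣<∣p∣ y∈T-x) ⟩
  1 + ∣ T - x ∣     ≤⟨ x∈p⇒∣p-x∣<∣p∣ x∈T ⟩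
  ∣ T ∣             ∎
  where
  open ≤-Reasoning
  avoids : ∀ {z v} → z ∉ S → v ∈ S → v ≢ z
  avoids z∉S v∈S v≡z = z∉S (subst (_∈ S) v≡z v∈S)
  S⊆T-x-y : S ⊆ T - x - y
  S⊆T-x-y v∈S =
    x∈p∧x≢y⇒x∈p-y (x∈p∧x≢y⇒x∈p-y (S⊆T v∈S) (avoids x∉S v∈S)) (avoids y∉S v∈S)
  y∈T-x : y ∈ T - x
  y∈T-x = x∈p∧x≢y⇒x∈p-y y∈T (λ y≡x → x≢y (≡-sym y≡x))

below : (k N : ℕ) → Subset N
below zero    N       = ∅
below (suc k) zero    = []
below (suc k) (suc N) = inside ∷ below k N

below-sound : ∀ {k N} {i : Fin N} → i ∈ below k N → toℕ i < k
below-sound {zero}           i∈ = ⊥-elim (∉⊥ i∈)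
below-sound {suc k} {suc N} {Fin.zero}  here       = s≤s z≤n
below-sound {suc k} {suc N} {Fin.suc i} (there i∈) = s≤s (below-sound i∈)

below-complete : ∀ {k N} {i : Fin N} → toℕ i < k → i ∈ below k N
below-complete {suc k} {suc N} {Fin.zero}  _       = here
below-complete {suc k} {suc N} {Fin.suc i} (s≤s p) = there (below-complete p)

∣below∣ : ∀ {k N} → k ≤ N → ∣ below k N ∣ ≡ k
∣below∣ {zero}  {N}     _       = ∣⊥∣≡0 N
∣below∣ {suc k} {suc N} (s≤s p) = cong suc (∣below∣ p)

vertexAt : ∀ {N} (j : ℕ) → j < N → Σ (Fin N) λ w → toℕ w ≡ j
vertexAt j j<N = fromℕ< j<N , toℕ-fromℕ< j<N

module _ {V : ℕ} (G : Graph V) where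

  ForcingClosed : (Fin V → Set) → Set
  ForcingClosed I = ∀ {v w} → I v → InN G v w →
    (∀ u → InN G v u → ¬ I u → u ≡ w) → I w

  observed-within : (S : Subset V) (I : Fin V → Set) →
    (∀ {v w} → v ∈ S → InN G v w → I w) → ForcingClosed I →
    ∀ i w → P G S i w → I w
  observed-within S I dom closed = go
    where
    go : ∀ i w → P G S i w → I w
    go zero    w (v , v∈S , vw)                    = dom v∈S vw
    go (suc i) w (inj₁ p)                          = go i w p
    go (suc i) w (inj₂ (v , pv , vw , _ , unique)) =
      closed (go i v pv) vw (λ u vu u∉I → unique u vu (λ pu → u∉I (go i u pu)))

  fails-outside : (S : Subset V) (I : Fin V → Set) →
    (∀ {v w} → v ∈ S → InN G v w → I w) → ForcingClosed I →
    (w : Fin V) → ¬ I w → IsFPDS G S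
  fails-outside S I dom closed w w∉I pds =
    w∉I (observed-within S I dom closed (proj₁ (pds w)) w (proj₂ (pds w)))

  empty-fails : Fin V → IsFPDS G ∅
  empty-fails w = fails-outside ∅ (λ _ → False) (λ v∈∅ _ → ∉⊥ v∈∅) (λ ()) w (λ ())

  P⁰? : (∀ u v → Dec (Adj G u v)) → (S : Subset V) (w : Fin V) → Dec (P G S 0 w)
  P⁰? adj? S w = any? (λ v → (v ∈? S) ×-dec ((w ≟ v) ⊎-dec adj? v w))

  one-step-completes : (S : Subset V) → (∀ w → Dec (P G S 0 w)) →
    (c : Fin V) → P G S 0 c → (∀ w → ¬ P G S 0 w → Adj G c w) →
    (∀ x y → ¬ P G S 0 x → ¬ P G S 0 y → x ≡ y) → IsPDS G S
  one-step-completes S P⁰?S c c∈ c-adj at-most-one w with P⁰?S w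
  ... | yes w∈ = 0 , w∈
  ... | no  w∉ =
    1 , inj₂ (c , c∈ , inj₂ (c-adj w w∉) , w∉ , λ u _ u∉ → at-most-one u w u∉ w∉)

data Side : Set where
  lower upper : Side

opposite : Side → Side
opposite lower = upper
opposite upper = lower

module Bipartite (m n : ℕ) where

  G : Graph (m + n)
  G = K m n

  InPart : Side → Fin (m + n) → Set
  InPart lower w = toℕ w < m
  InPart upper w = m ≤ toℕ w

  InPart? : ∀ s w → Dec (InPart s w)
  InPart? lower w = toℕ w <? m
  InPart? upper w = m ≤? toℕ w

  side-of : ∀ s w → InPart s w ⊎ InPart (opposite s) w
  side-of lower w with toℕ w <? m
  ... | yes w<m = inj₁ w<m
  ... | no  w≮m = inj₂ (≮⇒≥ w≮m)
  side-of upper w with m ≤? toℕ w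
  ... | yes m≤w = inj₁ m≤w
  ... | no  m≰w = inj₂ (≰⇒> m≰w)

  cross-adj : ∀ s {u v} → InPart s u → InPart (opposite s) v → Adj G u v
  cross-adj lower u∈ v∈ = inj₁ (u∈ , v∈)
  cross-adj upper u∈ v∈ = inj₂ (u∈ , v∈)

  adj? : ∀ u v → Dec (Adj G u v)
  adj? u v = (InPart? lower u ×-dec InPart? upper v) ⊎-dec
             (InPart? upper u ×-dec InPart? lower v)

  partSet : Side → Subset (m + n)
  partSet lower = below m (m + n)
  partSet upper = ∁ (below m (m + n))

  ∈partSet : ∀ s {w} → InPart s w → w ∈ partSet s
  ∈partSet lower w<m = below-complete w<m
  ∈partSet upper m≤w = x∉p⇒x∈∁p (λ w∈ → <⇒≱ (below-sound w∈) m≤w)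

  partSize : Side → ℕ
  partSize lower = m
  partSize upper = n

  ∣partSet∣ : ∀ s → ∣ partSet s ∣ ≡ partSize s
  ∣partSet∣ lower = ∣below∣ (m≤m+n m n)
  ∣partSet∣ upper = trans (∣∁p∣≡n∸∣p∣ (below m (m + n)))
                          (trans (cong (m + n ∸_) (∣below∣ (m≤m+n m n))) (m+n∸m≡n m n))

  module UpperBound (1≤n : 1 ≤ n) (n≤m : n ≤ m) where

    partSize≤m : ∀ s → partSize s ≤ m
    partSize≤m lower = ≤-reflexive refl
    partSize≤m upper = n≤m

    0<m : 0 < m
    0<m = ≤-trans 1≤n n≤m

    part-inhabited : ∀ s → ∃ (InPart s)
    part-inhabited lower =
      let (w , w≡0) = vertexAt 0 (≤-trans 0<m (m≤m+n m n))
      in w , subst (_< m) (≡-sym w≡0) 0<m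
    part-inhabited upper =
      let (w , w≡m) = vertexAt m (m<m+n m 1≤n)
      in w , ≤-reflexive (≡-sym w≡m)

    Meets : Side → Subset (m + n) → Set
    Meets s S = ∃ λ v → v ∈ S × InPart s v

    confined : ∀ s {S} → ¬ Meets (opposite s) S → ∀ {v} → v ∈ S → InPart s v
    confined s noOpp {v} v∈S with side-of s v
    ... | inj₁ v∈s   = v∈s
    ... | inj₂ v∈opp = ⊥-elim (noOpp (v , v∈S , v∈opp))

    meets-both-is-PDS : ∀ {S} → Meets lower S → Meets upper S → IsPDS G S
    meets-both-is-PDS (a , a∈S , a∈A) (b , b∈S , b∈B) w with side-of lower w
    ... | inj₁ w∈A = 0 , b , b∈S , inj₂ (cross-adj upper b∈B w∈A)
    ... | inj₂ w∈B = 0 , a , a∈S , inj₂ (cross-adj lower a∈A w∈B)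

    -- A set inside one part, meeting it, with more than m - 2 vertices, is
    -- power dominating: only vertices of its own part can be unobserved,
    -- at most one of them by counting, and a vertex of the other part forces it.
    one-sided-is-PDS : ∀ s {S} → Meets s S → (∀ {v} → v ∈ S → InPart s v) →
      m ∸ 2 < ∣ S ∣ → IsPDS G S
    one-sided-is-PDS s {S} (a , a∈S , a∈s) S⊆s large =
      one-step-completes G S (P⁰? G adj? S) c c-observed c-adj at-most-one
      where
      c : Fin (m + n)
      c = proj₁ (part-inhabited (opposite s))
      c∈opp : InPart (opposite s) c
      c∈opp = proj₂ (part-inhabited (opposite s))
      c-observed : P G S 0 c
      c-observed = a , a∈S , inj₂ (cross-adj s a∈s c∈opp)
      unobserved-in-part : ∀ w → ¬ P G S 0 w → InPart s w
      unobserved-in-part w w∉ with side-of s w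
      ... | inj₁ w∈s   = w∈s
      ... | inj₂ w∈opp = ⊥-elim (w∉ (a , a∈S , inj₂ (cross-adj s a∈s w∈opp)))
      unobserved-not-in-S : ∀ {w} → ¬ P G S 0 w → w ∉ S
      unobserved-not-in-S w∉ w∈S = w∉ (_ , w∈S , inj₁ refl)
      c-adj : ∀ w → ¬ P G S 0 w → Adj G c w
      c-adj w w∉ = sym G (cross-adj s (unobserved-in-part w w∉) c∈opp)
      at-most-one : ∀ x y → ¬ P G S 0 x → ¬ P G S 0 y → x ≡ y
      at-most-one x y x∉ y∉ with x ≟ y
      ... | yes x≡y = x≡y
      ... | no  x≢y = ⊥-elim (<⇒≱ large (∸-monoˡ-≤ 2 2+∣S∣≤m))
        where
        2+∣S∣≤m : 2 + ∣ S ∣ ≤ m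
        2+∣S∣≤m = ≤-trans
          (two-missing (λ v∈S → ∈partSet s (S⊆s v∈S))
            (∈partSet s (unobserved-in-part x x∉)) (∈partSet s (unobserved-in-part y y∉))
            x≢y (unobserved-not-in-S x∉) (unobserved-not-in-S y∉))
          (subst (_≤ m) (≡-sym (∣partSet∣ s)) (partSize≤m s))

    large-is-PDS : ∀ S → m ∸ 2 < ∣ S ∣ → IsPDS G S
    large-is-PDS S large
      with any? (λ v → (v ∈? S) ×-dec InPart? lower v)
         | any? (λ v → (v ∈? S) ×-dec InPart? upper v)
    ... | yes meetsA | yes meetsB = meets-both-is-PDS meetsA meetsB
    ... | yes meetsA | no  noB    = one-sided-is-PDS lower meetsA (confined lower noB) large
    ... | no  noA    | yes meetsB = one-sided-is-PDS upper meetsB (confined upper noA) large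
    ... | no  noA    | no  noB    = ⊥-elim (<⇒≱ large ∣S∣≤m∸2)
      where
      S⊆∅ : S ⊆ ∅
      S⊆∅ v∈S = ⊥-elim (noA (_ , v∈S , confined lower noB v∈S))
      ∣S∣≤m∸2 : ∣ S ∣ ≤ m ∸ 2
      ∣S∣≤m∸2 = ≤-trans (p⊆q⇒∣p∣≤∣q∣ S⊆∅) (≤-trans (≤-reflexive (∣⊥∣≡0 (m + n))) z≤n)

    fpds-bound : ∀ S → IsFPDS G S → ∣ S ∣ ≤ m ∸ 2
    fpds-bound S fails with ∣ S ∣ ≤? m ∸ 2
    ... | yes small = small
    ... | no  large = ⊥-elim (fails (large-is-PDS S (≰⇒> large)))

-- For m = k + 2 the first k vertices form a failed power dominating set:
-- S ∪ B is forcing-closed, since a vertex of B sees both k and k + 1.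
module LowerBound (k n : ℕ) where
  m : ℕ
  m = 2 + k

  G : Graph (m + n)
  G = K m n

  S : Subset (m + n)
  S = below k (m + n)

  Observable : Fin (m + n) → Set
  Observable w = toℕ w < k ⊎ m ≤ toℕ w

  unobservable : ∀ {w} → k ≤ toℕ w → toℕ w < m → ¬ Observable w
  unobservable k≤w w<m (inj₁ w<k) = <⇒≱ w<k k≤w
  unobservable k≤w w<m (inj₂ m≤w) = <⇒≱ w<m m≤w

  k<m : k < m
  k<m = ≤-trans (n<1+n k) (n≤1+n (suc k))

  vertex-k vertex-k+1 : Σ (Fin (m + n)) λ w → toℕ w ≡ _
  vertex-k   = vertexAt k       (≤-trans k<m (m≤m+n m n))
  vertex-k+1 = vertexAt (suc k) (≤-trans (n<1+n (suc k)) (m≤m+n m n))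

  x y : Fin (m + n)
  x = proj₁ vertex-k
  y = proj₁ vertex-k+1

  x<m : toℕ x < m
  x<m = subst (_< m) (≡-sym (proj₂ vertex-k)) k<m
  y<m : toℕ y < m
  y<m = subst (_< m) (≡-sym (proj₂ vertex-k+1)) (n<1+n (suc k))

  x∉ : ¬ Observable x
  x∉ = unobservable (≤-reflexive (≡-sym (proj₂ vertex-k))) x<m
  y∉ : ¬ Observable y
  y∉ = unobservable (subst (k ≤_) (≡-sym (proj₂ vertex-k+1)) (n≤1+n k)) y<m

  x≢y : x ≢ y
  x≢y x≡y = 1+n≢n (trans (≡-sym (proj₂ vertex-k+1)) (trans (cong toℕ (≡-sym x≡y)) (proj₂ vertex-k)))

  x-adj : ∀ {v} → m ≤ toℕ v → Adj G v x
  x-adj m≤v = inj₂ (m≤v , x<m)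
  y-adj : ∀ {v} → m ≤ toℕ v → Adj G v y
  y-adj m≤v = inj₂ (m≤v , y<m)

  dominated : ∀ {v w} → v ∈ S → InN G v w → Observable w
  dominated v∈S (inj₁ refl)                = inj₁ (below-sound v∈S)
  dominated v∈S (inj₂ (inj₁ (_ , m≤w)))    = inj₂ m≤w
  dominated v∈S (inj₂ (inj₂ (m≤v , _)))    = ⊥-elim (<⇒≱ (<-trans (below-sound v∈S) k<m) m≤v)

  -- a vertex of S has no unobservable neighbour; one of B has two, x and y
  closed : ForcingClosed G Observable
  closed v∈ (inj₁ refl) _                              = v∈
  closed _ (inj₂ (inj₁ (_ , m≤w))) _                   = inj₂ m≤w
  closed (inj₁ v<k) (inj₂ (inj₂ (m≤v , _))) _          = ⊥-elim (<⇒≱ (<-trans v<k k<m) m≤v)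
  closed (inj₂ m≤v) (inj₂ (inj₂ (_ , _))) only-missing =
    ⊥-elim (x≢y (trans (only-missing x (inj₂ (x-adj m≤v)) x∉)
                       (≡-sym (only-missing y (inj₂ (y-adj m≤v)) y∉))))

  below-fails : IsFPDS G S
  below-fails = fails-outside G S Observable dominated closed x x∉

  ∣S∣ : ∣ S ∣ ≡ k
  ∣S∣ = ∣below∣ (≤-trans (m≤m+n k n) (m≤n+m (k + n) 2))

theorem6 : (m n : ℕ) → 1 ≤ n → n ≤ m →
    (2 ≤ m → FPDSNumber (K m n) (m ∸ 2)) × (m < 2 → FPDSNumber (K m n) 0)
theorem6 zero (suc _) _ ()
theorem6 (suc zero) n 1≤n n≤1 =
  (λ { (s≤s ()) }) ,
  (λ _ → (∅ , empty-fails (K 1 n) Fin.zero , ∣⊥∣≡0 (1 + n)) , fpds-bound)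
  where open Bipartite.UpperBound 1 n 1≤n n≤1
theorem6 (suc (suc k)) n 1≤n n≤m =
  (λ _ → (S , below-fails , ∣S∣) , fpds-bound) ,
  (λ { (s≤s (s≤s ())) })
  where
  open LowerBound k n
  open Bipartite.UpperBound (2 + k) n 1≤n n≤m
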